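{- Let $w$ be a palindromic factor of the Thue–Morse word $t$. Then $|w|$ is divisible by $4$ if and only if $w=\varphi(u)$ for some word $u\in\{0,1\}^*$, i.e. $w$ can be factored as a concatenation of blocks from $\{01,10\}$.
   Context: $\varphi$ is the morphism $0\mapsto01,\ 1\mapsto10$, and the Thue–Morse word $t$ is its fixed point beginning with $0$. A palindrome is a word equal to its reversal. -}

module Defs where

open import Data.Bool using (Bool; true; false)
open import Data.Nat using (ℕ; zero; suc; _+_; _^_)
open import Data.List using (List; []; _∷_; _++_; concatMap; length; reverse; map; upTo)
open import Data.List.Properties using (length-++)
open import Data.Product using (Σ; ∃; _×_; _,_)
open import Relation.Binary.PropositionalEquality using (_≡_)

-- Letters: false = 0, true = 1.
Word : Set
Word = List Bool

φ₁ : Bool → Word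
φ₁ false = false ∷ true ∷ []
φ₁ true  = true ∷ false ∷ []

φ : Word → Word
φ = concatMap φ₁

φ^ : ℕ → Word → Word
φ^ zero    w = w
φ^ (suc k) w = φ (φ^ k w)

-- n-th letter of a word (default false if out of range; never used out of range below)
at : Word → ℕ → Bool
at []       _       = false
at (x ∷ w) zero    = x
at (x ∷ w) (suc n) = at w n

-- Thue–Morse word t = lim φ^k(0): its n-th letter is the n-th letter of
-- φ^(n+1)(0), which has length 2^(n+1) > n, and every φ^k(0) is a prefix of φ^(k+1)(0).
t : ℕ → Bool
t n = at (φ^ (suc n) (false ∷ [])) n

factorAt : ℕ → ℕ → Word
factorAt i zero    = []
factorAt i (suc m) = t i ∷ factorAt (suc i) m

IsFactor : Word → Set
IsFactor w = ∃ λ i → w ≡ factorAt i (length w)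

IsPalindrome : Word → Set
IsPalindrome w = reverse w ≡ w

-- A factor of t starting at an even position 2k is φ of the factor starting at k, because
-- t(2k) = t(k) and t(2k+1) = ¬t(k); so a factor of length 4q is either such an image or starts
-- at an odd position. In the latter case, if it is a nonempty palindrome, its two central
-- letters are equal, yet they sit at positions 2j and 2j+1, where t takes different values.
-- Conversely, reversal turns φ(u) into φ of the complemented reversal of u, so φ(u) is a
-- palindrome exactly when u equals its complemented reversal; such a u cannot have odd length
-- (its central letter would equal its complement), whence |φ(u)| = 2|u| is divisible by 4.
module Submission where

open import Defs
open import Data.Bool using (true; false; not)
open import Data.Bool.Properties using (not-¬)
open import Data.Empty using (⊥-elim)
open import Data.List using (List; []; _∷_; _++_; _∷ʳ_; [_]; concatMap; length; reverse; map)
open import Data.List.Properties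
  using (∷-injectiveˡ; ∷-injectiveʳ; ++-assoc; ++-identityʳ; concatMap-++; concatMap-cong;
         concatMap-map; length-reverse; reverse-++; unfold-reverse)
open import Data.Nat using (ℕ; zero; suc; _+_; _*_; _≤_; _<_; _≤′_; ≤′-refl; ≤′-step; z≤n; s≤s)
open import Data.Nat.Divisibility using (_∣_; divides)
open import Data.Nat.Properties
  using (+-identityʳ; +-suc; m≤m+n; m≤n+m; <⇒≤; ≤-trans; ≤-total; ≤⇒≤′; suc-injective)
open import Data.Product using (∃; _,_)
open import Data.Sum using (_⊎_; inj₁; inj₂)
open import Function using (_∘_)
open import Function.Bundles using (_⇔_; mk⇔)
open import Relation.Binary.PropositionalEquality
  using (_≡_; refl; sym; trans; cong; cong₂; subst; module ≡-Reasoning)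
open import Relation.Nullary using (¬_)

open ≡-Reasoning

double : ℕ → ℕ
double zero    = zero
double (suc n) = suc (suc (double n))

double≡+ : ∀ n → double n ≡ n + n
double≡+ zero    = refl
double≡+ (suc n) = cong suc (trans (cong suc (double≡+ n)) (sym (+-suc n n)))

m≤double : ∀ m → m ≤ double m
m≤double m = subst (m ≤_) (sym (double≡+ m)) (m≤m+n m m)

double-< : ∀ {m n} → m < n → suc (double m) < double n
double-< {zero}  {suc n} _       = s≤s (s≤s z≤n)
double-< {suc m} {suc n} (s≤s h) = s≤s (s≤s (double-< h))

double∘double≡*4 : ∀ q → double (double q) ≡ q * 4
double∘double≡*4 zero    = refl
double∘double≡*4 (suc q) = cong (suc ∘ suc ∘ suc ∘ suc) (double∘double≡*4 q)

odd+odd : ∀ k q → suc (double k) + suc (double q) ≡ double (suc (k + q))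
odd+odd zero    q = refl
odd+odd (suc k) q = cong (suc ∘ suc) (odd+odd k q)

even⊎odd : ∀ n → (∃ λ k → n ≡ double k) ⊎ (∃ λ k → n ≡ suc (double k))
even⊎odd zero = inj₁ (0 , refl)
even⊎odd (suc n) with even⊎odd n
... | inj₁ (k , n≡) = inj₂ (k , cong suc n≡)
... | inj₂ (k , n≡) = inj₁ (suc k , cong suc n≡)

at-++ˡ : ∀ p {q n} → n < length p → at (p ++ q) n ≡ at p n
at-++ˡ (x ∷ p) {n = zero}  _       = refl
at-++ˡ (x ∷ p) {n = suc n} (s≤s h) = at-++ˡ p h

at-∷ʳ : ∀ p {x} → at (p ∷ʳ x) (length p) ≡ x
at-∷ʳ []      = refl
at-∷ʳ (y ∷ p) = at-∷ʳ p

at-map : ∀ f w {n} → n < length w → at (map f w) n ≡ f (at w n)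
at-map f (x ∷ w) {zero}  _       = refl
at-map f (x ∷ w) {suc n} (s≤s h) = at-map f w h

at-reverse : ∀ w {i j} → suc (i + j) ≡ length w → at (reverse w) i ≡ at w j
at-reverse (x ∷ w) {i} {zero} e = begin
  at (reverse (x ∷ w)) i                   ≡⟨ cong (λ v → at v i) (unfold-reverse x w) ⟩
  at (reverse w ∷ʳ x) i                    ≡⟨ cong (at (reverse w ∷ʳ x)) i≡ ⟩
  at (reverse w ∷ʳ x) (length (reverse w)) ≡⟨ at-∷ʳ (reverse w) ⟩
  x                                        ∎
  where
  i≡ : i ≡ length (reverse w)
  i≡ = trans (sym (+-identityʳ i)) (trans (suc-injective e) (sym (length-reverse w)))
at-reverse (x ∷ w) {i} {suc j} e = begin
  at (reverse (x ∷ w)) i ≡⟨ cong (λ v → at v i) (unfold-reverse x w) ⟩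
  at (reverse w ∷ʳ x) i  ≡⟨ at-++ˡ (reverse w) i< ⟩
  at (reverse w) i       ≡⟨ at-reverse w e′ ⟩
  at w j                 ∎
  where
  e′ : suc (i + j) ≡ length w
  e′ = trans (sym (+-suc i j)) (suc-injective e)
  i< : i < length (reverse w)
  i< = subst (i <_) (trans e′ (sym (length-reverse w))) (s≤s (m≤m+n i j))

at-palindrome : ∀ {w i j} → IsPalindrome w → suc (i + j) ≡ length w → at w i ≡ at w j
at-palindrome {w} {i} pal e = trans (cong (λ v → at v i) (sym pal)) (at-reverse w e)

reverse-concatMap : ∀ {A B : Set} (f : A → List B) xs →
                    reverse (concatMap f xs) ≡ concatMap (reverse ∘ f) (reverse xs)
reverse-concatMap f []       = refl
reverse-concatMap f (x ∷ xs) = begin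
  reverse (f x ++ concatMap f xs)              ≡⟨ reverse-++ (f x) (concatMap f xs) ⟩
  reverse (concatMap f xs) ++ reverse (f x)    ≡⟨ cong₂ _++_ (reverse-concatMap f xs) (sym (++-identityʳ _)) ⟩
  concatMap (reverse ∘ f) (reverse xs) ++ concatMap (reverse ∘ f) [ x ]
    ≡⟨ sym (concatMap-++ (reverse ∘ f) (reverse xs) [ x ]) ⟩
  concatMap (reverse ∘ f) (reverse xs ∷ʳ x)
    ≡⟨ cong (concatMap (reverse ∘ f)) (sym (unfold-reverse x xs)) ⟩
  concatMap (reverse ∘ f) (reverse (x ∷ xs))
    ∎

φ-∷ : ∀ x w → φ (x ∷ w) ≡ x ∷ not x ∷ φ w
φ-∷ false w = refl
φ-∷ true  w = refl

φ-++ : ∀ u v → φ (u ++ v) ≡ φ u ++ φ v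
φ-++ = concatMap-++ φ₁

length-φ : ∀ w → length (φ w) ≡ double (length w)
length-φ []      = refl
length-φ (x ∷ w) = trans (cong length (φ-∷ x w)) (cong (suc ∘ suc) (length-φ w))

φ-injective : ∀ {u v} → φ u ≡ φ v → u ≡ v
φ-injective {[]}    {[]}    _ = refl
φ-injective {[]}    {y ∷ v} e with () ← trans e (φ-∷ y v)
φ-injective {x ∷ u} {[]}    e with () ← trans (sym (φ-∷ x u)) e
φ-injective {x ∷ u} {y ∷ v} e =
  cong₂ _∷_ (∷-injectiveˡ e′) (φ-injective (∷-injectiveʳ (∷-injectiveʳ e′)))
  where
  e′ : x ∷ not x ∷ φ u ≡ y ∷ not y ∷ φ v
  e′ = trans (sym (φ-∷ x u)) (trans e (φ-∷ y v))

reverse-φ₁ : ∀ x → reverse (φ₁ x) ≡ φ₁ (not x)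
reverse-φ₁ false = refl
reverse-φ₁ true  = refl

reverse-φ : ∀ u → reverse (φ u) ≡ φ (map not (reverse u))
reverse-φ u = begin
  reverse (φ u)                         ≡⟨ reverse-concatMap φ₁ u ⟩
  concatMap (reverse ∘ φ₁) (reverse u) ≡⟨ concatMap-cong reverse-φ₁ (reverse u) ⟩
  concatMap (φ₁ ∘ not) (reverse u)     ≡⟨ sym (concatMap-map φ₁ not (reverse u)) ⟩
  φ (map not (reverse u))              ∎

at-φ-double : ∀ w n → at (φ w) (double n) ≡ at w n
at-φ-double []      n       = refl
at-φ-double (x ∷ w) zero    = cong (λ v → at v zero) (φ-∷ x w)
at-φ-double (x ∷ w) (suc n) = trans (cong (λ v → at v (double (suc n))) (φ-∷ x w)) (at-φ-double w n)

at-φ-suc-double : ∀ w {n} → n < length w → at (φ w) (suc (double n)) ≡ not (at w n)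
at-φ-suc-double (x ∷ w) {zero}  _       = cong (λ v → at v 1) (φ-∷ x w)
at-φ-suc-double (x ∷ w) {suc n} (s≤s h) =
  trans (cong (λ v → at v (suc (double (suc n)))) (φ-∷ x w)) (at-φ-suc-double w h)

tm : ℕ → Word
tm k = φ^ k (false ∷ [])

tm-step : ∀ k → ∃ λ q → tm (suc k) ≡ tm k ++ q
tm-step zero    = true ∷ [] , refl
tm-step (suc k) = let q , e = tm-step k in φ q , trans (cong φ e) (φ-++ (tm k) q)

tm-prefix : ∀ {j k} → j ≤ k → ∃ λ q → tm k ≡ tm j ++ q
tm-prefix = prefix′ ∘ ≤⇒≤′
  where
  prefix′ : ∀ {j k} → j ≤′ k → ∃ λ q → tm k ≡ tm j ++ q
  prefix′ {j} ≤′-refl = [] , sym (++-identityʳ (tm j))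
  prefix′ {j} (≤′-step {k} h) =
    let q , e = prefix′ h ; r , e′ = tm-step k
    in q ++ r , trans e′ (trans (cong (_++ r) e) (++-assoc (tm j) q r))

at-tm-stable : ∀ {j k n} → j ≤ k → n < length (tm j) → at (tm k) n ≡ at (tm j) n
at-tm-stable {j} {n = n} j≤k h =
  let q , e = tm-prefix j≤k in trans (cong (λ v → at v n) e) (at-++ˡ (tm j) h)

n<length-tm[1+n] : ∀ n → n < length (tm (suc n))
n<length-tm[1+n] zero    = s≤s z≤n
n<length-tm[1+n] (suc n) =
  subst (suc n <_) (sym (length-φ (tm (suc n))))
        (≤-trans (s≤s (s≤s (m≤double n))) (double-< (n<length-tm[1+n] n)))

t≡at-tm : ∀ j {n} → n < length (tm j) → t n ≡ at (tm j) n
t≡at-tm j {n} h with ≤-total j (suc n)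
... | inj₁ j≤1+n = at-tm-stable j≤1+n h
... | inj₂ 1+n≤j = sym (at-tm-stable 1+n≤j (n<length-tm[1+n] n))

t-double : ∀ k → t (double k) ≡ t k
t-double k = trans (t≡at-tm (suc (suc k)) 2k<) (at-φ-double (tm (suc k)) k)
  where
  2k< : double k < length (tm (suc (suc k)))
  2k< = subst (double k <_) (sym (length-φ (tm (suc k)))) (<⇒≤ (double-< (n<length-tm[1+n] k)))

t-suc-double : ∀ k → t (suc (double k)) ≡ not (t k)
t-suc-double k =
  trans (t≡at-tm (suc (suc k)) 2k+1<) (at-φ-suc-double (tm (suc k)) (n<length-tm[1+n] k))
  where
  2k+1< : suc (double k) < length (tm (suc (suc k)))
  2k+1< = subst (suc (double k) <_) (sym (length-φ (tm (suc k)))) (double-< (n<length-tm[1+n] k))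

length-factorAt : ∀ i n → length (factorAt i n) ≡ n
length-factorAt i zero    = refl
length-factorAt i (suc n) = cong suc (length-factorAt (suc i) n)

at-factorAt : ∀ i {n j} → j < n → at (factorAt i n) j ≡ t (i + j)
at-factorAt i {suc n} {zero}  _       = cong t (sym (+-identityʳ i))
at-factorAt i {suc n} {suc j} (s≤s h) = trans (at-factorAt (suc i) h) (cong t (sym (+-suc i j)))

factorAt-double : ∀ k m → factorAt (double k) (double m) ≡ φ (factorAt k m)
factorAt-double k zero    = refl
factorAt-double k (suc m) = begin
  t (double k) ∷ t (suc (double k)) ∷ factorAt (double (suc k)) (double m)
    ≡⟨ cong₂ (λ x y → x ∷ y ∷ factorAt (double (suc k)) (double m)) (t-double k) (t-suc-double k) ⟩
  t k ∷ not (t k) ∷ factorAt (double (suc k)) (double m)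
    ≡⟨ cong (λ v → t k ∷ not (t k) ∷ v) (factorAt-double (suc k) m) ⟩
  t k ∷ not (t k) ∷ φ (factorAt (suc k) m)
    ≡⟨ sym (φ-∷ (t k) (factorAt (suc k) m)) ⟩
  φ (factorAt k (suc m))
    ∎

palindromic-factor-centre : ∀ i a → IsPalindrome (factorAt i (double (suc a))) →
                            t (i + a) ≡ t (suc (i + a))
palindromic-factor-centre i a pal = begin
  t (i + a)      ≡⟨ sym (at-factorAt i a<) ⟩
  at w a         ≡⟨ at-palindrome {i = a} pal mirror ⟩
  at w (suc a)   ≡⟨ at-factorAt i 1+a< ⟩
  t (i + suc a)  ≡⟨ cong t (+-suc i a) ⟩
  t (suc (i + a)) ∎
  where
  w : Word
  w = factorAt i (double (suc a))
  a+1+a≡ : suc (a + suc a) ≡ double (suc a)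
  a+1+a≡ = sym (double≡+ (suc a))
  mirror : suc (a + suc a) ≡ length w
  mirror = trans a+1+a≡ (sym (length-factorAt i _))
  a< : a < double (suc a)
  a< = subst (a <_) a+1+a≡ (s≤s (m≤m+n a (suc a)))
  1+a< : suc a < double (suc a)
  1+a< = subst (suc a <_) a+1+a≡ (s≤s (m≤n+m (suc a) a))

odd-position-¬palindrome : ∀ k q → ¬ IsPalindrome (factorAt (suc (double k)) (double (double (suc q))))
odd-position-¬palindrome k q pal = not-¬ refl (begin
  t j                   ≡⟨ sym (t-double j) ⟩
  t (double j)          ≡⟨ cong t (sym (odd+odd k q)) ⟩
  t (i + a)             ≡⟨ palindromic-factor-centre i a pal ⟩
  t (suc (i + a))       ≡⟨ cong (t ∘ suc) (odd+odd k q) ⟩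
  t (suc (double j))    ≡⟨ t-suc-double j ⟩
  not (t j)             ∎)
  where
  i a j : ℕ
  i = suc (double k)
  a = suc (double q)
  j = suc (k + q)

palindromic-factor-4q : ∀ i q → IsPalindrome (factorAt i (double (double q))) →
                        ∃ λ u → factorAt i (double (double q)) ≡ φ u
palindromic-factor-4q i q pal with even⊎odd i | q
... | inj₁ (k , refl) | q      = factorAt k (double q) , factorAt-double k (double q)
... | inj₂ (k , refl) | zero   = [] , refl
... | inj₂ (k , refl) | suc q′ = ⊥-elim (odd-position-¬palindrome k q′ pal)

antipalindrome-even : ∀ u → map not (reverse u) ≡ u → ∃ λ p → length u ≡ double p
antipalindrome-even u e with even⊎odd (length u)
... | inj₁ even = even
... | inj₂ (m , |u|≡) = ⊥-elim (not-¬ refl (begin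
  at u m                       ≡⟨ cong (λ v → at v m) (sym e) ⟩
  at (map not (reverse u)) m   ≡⟨ at-map not (reverse u) m< ⟩
  not (at (reverse u) m)       ≡⟨ cong not (at-reverse u mirror) ⟩
  not (at u m)                 ∎))
  where
  mirror : suc (m + m) ≡ length u
  mirror = sym (trans |u|≡ (cong suc (double≡+ m)))
  m< : m < length (reverse u)
  m< = subst (m <_) (sym (trans (length-reverse u) |u|≡)) (s≤s (m≤double m))

palindromic-φ-4∣length : ∀ u → IsPalindrome (φ u) → 4 ∣ length (φ u)
palindromic-φ-4∣length u pal =
  let p , |u|≡ = antipalindrome-even u (φ-injective (trans (sym (reverse-φ u)) pal))
  in divides p (trans (length-φ u) (trans (cong double |u|≡) (double∘double≡*4 p)))

lemma5p1 : (w : Word) → IsFactor w → IsPalindrome w →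
    (4 ∣ length w) ⇔ (∃ λ (u : Word) → w ≡ φ u)
lemma5p1 w (i , w≡) pal = mk⇔ to from
  where
  to : 4 ∣ length w → ∃ λ u → w ≡ φ u
  to (divides q |w|≡) =
    let w≡′ = trans w≡ (cong (factorAt i) (trans |w|≡ (sym (double∘double≡*4 q))))
        u , e = palindromic-factor-4q i q (subst IsPalindrome w≡′ pal)
    in u , trans w≡′ e
  from : (∃ λ u → w ≡ φ u) → 4 ∣ length w
  from (u , refl) = palindromic-φ-4∣length u pal
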